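{- Let $\pi$ be a permutation and $f$ an index of $\pi$. If $s$ is a longest subsequence of $\pi$ that avoids $213$ and $231$ among those whose last element is $\pi[f]$, then the subsequence of $s$ consisting of its ascent elements together with its last element is a longest increasing subsequence of $\pi$ with last element at index $f$, and the subsequence of $s$ consisting of its descent elements together with its last element is a longest decreasing subsequence of $\pi$ with last element at index $f$.
   Context: A sequence of distinct integers avoids $213$ and $231$ if it has no subsequence with the same relative order as $213$ or $231$. For a sequence $s=s_1\cdots s_m$ and $1\le r<m$, $s_r$ is an ascent element if $s_r<s_{r+1}$ and a descent element if $s_r>s_{r+1}$. -}

module Defs where

open import Data.Nat using (ℕ; _≤_)
open import Data.Fin using (Fin; _<_; _<?_)
open import Data.List using (List; []; _∷_; map; length; last)
open import Data.List.Relation.Unary.Linked using (Linked)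
open import Data.List.Relation.Binary.Sublist.Propositional using (_⊆_)
open import Data.Maybe using (Maybe; just)
open import Data.Product using (∃; _×_; _,_)
open import Relation.Nullary using (¬_; yes; no)
open import Relation.Binary.PropositionalEquality using (_≡_)
open import Function.Definitions using (Injective)

IsPermutation : {n : ℕ} → (Fin n → Fin n) → Set
IsPermutation π = Injective _≡_ _≡_ π

-- A subsequence of π is given by a strictly increasing list of indices.
IsSubseq : {n : ℕ} → List (Fin n) → Set
IsSubseq is = Linked _<_ is

Contains213 : {n : ℕ} → List (Fin n) → Set
Contains213 s = ∃ λ a → ∃ λ b → ∃ λ c → (a ∷ b ∷ c ∷ []) ⊆ s × b < a × a < c

Contains231 : {n : ℕ} → List (Fin n) → Set
Contains231 s = ∃ λ a → ∃ λ b → ∃ λ c → (a ∷ b ∷ c ∷ []) ⊆ s × c < a × a < b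

Avoids213-231 : {n : ℕ} → List (Fin n) → Set
Avoids213-231 s = ¬ Contains213 s × ¬ Contains231 s

module _ {n : ℕ} (π : Fin n → Fin n) where

  vals : List (Fin n) → List (Fin n)
  vals is = map π is

  AvoidEndingAt : Fin n → List (Fin n) → Set
  AvoidEndingAt f is = IsSubseq is × Avoids213-231 (vals is) × last (vals is) ≡ just (π f)

  IncEndingAt : Fin n → List (Fin n) → Set
  IncEndingAt f is = IsSubseq is × Linked (λ i j → π i < π j) is × last is ≡ just f

  DecEndingAt : Fin n → List (Fin n) → Set
  DecEndingAt f is = IsSubseq is × Linked (λ i j → π j < π i) is × last is ≡ just f

  ascentsFrom : Fin n → List (Fin n) → List (Fin n)
  ascentsFrom x [] = x ∷ []
  ascentsFrom x (y ∷ r) with π x <? π y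
  ... | yes _ = x ∷ ascentsFrom y r
  ... | no _  = ascentsFrom y r

  ascentsAndLast : List (Fin n) → List (Fin n)
  ascentsAndLast [] = []
  ascentsAndLast (x ∷ r) = ascentsFrom x r

  descentsFrom : Fin n → List (Fin n) → List (Fin n)
  descentsFrom x [] = x ∷ []
  descentsFrom x (y ∷ r) with π y <? π x
  ... | yes _ = x ∷ descentsFrom y r
  ... | no _  = descentsFrom y r

  descentsAndLast : List (Fin n) → List (Fin n)
  descentsAndLast [] = []
  descentsAndLast (x ∷ r) = descentsFrom x r

IsLongest : {n : ℕ} → (List (Fin n) → Set) → List (Fin n) → Set
IsLongest P s = P s × (∀ t → P t → length t ≤ length s)

-- A sequence of distinct values avoids 213 and 231 exactly when each entry is
-- the minimum or the maximum of the entries from it onwards. In such a sequence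
-- s ending at π[f] the minima are the ascent elements and the maxima the descent
-- elements, so ascents-and-last is increasing, descents-and-last is decreasing,
-- and their lengths add up to |s| + 1. Conversely, an increasing sequence I and a
-- decreasing sequence D ending at index f merge by index into such a sequence of
-- length |I| + |D| - 1, because the entries of I other than π[f] lie below π[f]
-- and those of D above it. Maximality of s then bounds |I| + |desc| and
-- |asc| + |D| by |asc| + |desc|.

module Submission where

open import Defs
open import Data.Nat using (ℕ)
open import Data.Fin using (Fin)
open import Data.List using (List)
open import Data.Product using (_×_)

open import Data.Nat as ℕ using (suc; _+_; s≤s)
open import Data.Nat.Properties using (+-suc; +-comm; +-cancelʳ-≤; +-cancelˡ-≤; ≤-trans; ≤-reflexive; module ≤-Reasoning)
open import Data.Fin using (_<_; _<?_)
open import Data.Fin.Properties using (<-cmp; <-trans; <-asym; <⇒≢)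
open import Data.List using ([]; _∷_; _∷ʳ_; map; length; last)
open import Data.List.Properties using (last-map; length-++)
open import Data.List.Membership.Propositional using (_∈_)
open import Data.List.Relation.Unary.All as All using (All; []; _∷_)
open import Data.List.Relation.Unary.All.Properties as All using ()
open import Data.List.Relation.Unary.Any using (here; there)
open import Data.List.Relation.Unary.AllPairs as AllPairs using (AllPairs; []; _∷_)
open import Data.List.Relation.Unary.Linked as Linked using (Linked; []; [-]; _∷_)
open import Data.List.Relation.Unary.Linked.Properties using (AllPairs⇒Linked; Linked⇒AllPairs; Linked⇒All)
open import Data.List.Relation.Unary.Unique.Propositional using (Unique)
open import Data.List.Relation.Unary.Unique.Propositional.Properties as Unique using ()
open import Data.List.Relation.Binary.Disjoint.Propositional using (Disjoint)
open import Data.List.Relation.Binary.Pointwise.Properties as Pointwise using ()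
open import Data.List.Relation.Binary.Permutation.Propositional using (↭-sym)
open import Data.List.Relation.Binary.Permutation.Propositional.Properties using (All-resp-↭)
open import Data.List.Relation.Binary.Sublist.Propositional as Sublist using (_⊆_; []; _∷_; from∈)
open import Data.List.Relation.Binary.Sublist.Propositional.Properties using (All-resp-⊆)
open import Data.List.Relation.Ternary.Interleaving.Propositional using (Interleaving; []; consˡ; consʳ; left; right; toPermutation)
open import Data.List.Relation.Ternary.Interleaving.Properties using (interleave-length)
open import Data.Maybe as Maybe using (just; nothing)
open import Data.Maybe.Properties using (just-injective)
open import Data.Product using (∃; _,_)
open import Data.Sum using (_⊎_; inj₁; inj₂)
open import Data.Empty using (⊥; ⊥-elim)
open import Function using (_on_; flip; _∘_)
open import Function.Definitions using (Injective)
open import Level using (Level; _⊔_)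
open import Relation.Nullary using (yes; no)
open import Relation.Binary using (Rel; Transitive; Trichotomous; tri<; tri≈; tri>)
open import Relation.Binary.PropositionalEquality using (_≡_; refl; sym; trans; cong; cong₂; module ≡-Reasoning)

private
  variable
    a ℓ : Level
    A B : Set a
    x y : A
    xs ys zs : List A

last-∷ : (xs : List A) → last xs ≡ just y → last (x ∷ xs) ≡ just y
last-∷ (_ ∷ _) e = e

last-∷ʳ : (xs : List A) (x : A) → last (xs ∷ʳ x) ≡ just x
last-∷ʳ []           x = refl
last-∷ʳ (y ∷ [])     x = refl
last-∷ʳ (y ∷ z ∷ xs) x = last-∷ʳ (z ∷ xs) x

last⇒∷ʳ : last xs ≡ just x → ∃ λ ys → xs ≡ ys ∷ʳ x
last⇒∷ʳ {xs = y ∷ []} refl = [] , refl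
last⇒∷ʳ {xs = y ∷ z ∷ xs} e with last⇒∷ʳ {xs = z ∷ xs} e
... | ys , eq = y ∷ ys , cong (y ∷_) eq

last-map-injective : {f : A → B} → Injective _≡_ _≡_ f → last (map f xs) ≡ just (f x) → last xs ≡ just x
last-map-injective {xs = xs} {f = f} inj e with last xs | last-map f xs
... | just _ | q = cong just (inj (just-injective (trans (sym q) e)))
... | nothing | q with () ← trans (sym e) q

length-∷ʳ : (xs : List A) (x : A) → length (xs ∷ʳ x) ≡ suc (length xs)
length-∷ʳ xs x = trans (length-++ xs) (+-comm (length xs) 1)

module _ {R : Rel A ℓ} where

  All⇒Linked-∷ : All (R x) xs → Linked R xs → Linked R (x ∷ xs)
  All⇒Linked-∷ []      _ = [-]
  All⇒Linked-∷ (r ∷ _) l = r ∷ l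

  Linked-∷ʳ⁺ : Linked R xs → All (flip R y) xs → Linked R (xs ∷ʳ y)
  Linked-∷ʳ⁺ []      []       = [-]
  Linked-∷ʳ⁺ [-]     (r ∷ []) = r ∷ [-]
  Linked-∷ʳ⁺ (r ∷ l) (_ ∷ rs) = r ∷ Linked-∷ʳ⁺ l rs

  AllPairs-resp-⊆ : xs ⊆ ys → AllPairs R ys → AllPairs R xs
  AllPairs-resp-⊆ []                 []       = []
  AllPairs-resp-⊆ (_ Sublist.∷ʳ sub) (_ ∷ rs) = AllPairs-resp-⊆ sub rs
  AllPairs-resp-⊆ (refl ∷ sub)       (r ∷ rs) = All-resp-⊆ sub r ∷ AllPairs-resp-⊆ sub rs

  module _ (R-trans : Transitive R) where

    Linked⇒All-head : Linked R (x ∷ xs) → All (R x) xs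
    Linked⇒All-head [-]     = []
    Linked⇒All-head (r ∷ l) = Linked⇒All R-trans r l

    Linked-∷ʳ⁻ : Linked R (xs ∷ʳ y) → Linked R xs × All (flip R y) xs
    Linked-∷ʳ⁻ {xs = []}         _         = [] , []
    Linked-∷ʳ⁻ {xs = _ ∷ []}     (r ∷ [-]) = [-] , r ∷ []
    Linked-∷ʳ⁻ {xs = _ ∷ x ∷ xs} {y} (r ∷ l) with Linked-∷ʳ⁻ {xs = x ∷ xs} {y} l
    ... | l′ , rs@(r′ ∷ _) = r ∷ l′ , R-trans r r′ ∷ rs

    Linked-resp-⊆ : xs ⊆ ys → Linked R ys → Linked R xs
    Linked-resp-⊆ sub l = AllPairs⇒Linked (AllPairs-resp-⊆ sub (Linked⇒AllPairs R-trans l))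

All-interleaving : {P : A → Set ℓ} → Interleaving xs ys zs → All P xs → All P ys → All P zs
All-interleaving sp pxs pys = All-resp-↭ (↭-sym (toPermutation sp)) (All.++⁺ pxs pys)

module _ {A : Set a} (R : Rel A ℓ) where

  data Extremal : List A → Set (a ⊔ ℓ) where
    []   : Extremal []
    min∷ : All (R x) xs → Extremal xs → Extremal (x ∷ xs)
    max∷ : All (flip R x) xs → Extremal xs → Extremal (x ∷ xs)

module _ {R : Rel A ℓ} where

  Extremal-tail : Extremal R (x ∷ xs) → Extremal R xs
  Extremal-tail (min∷ _ e) = e
  Extremal-tail (max∷ _ e) = e

  Extremal-resp-⊆ : xs ⊆ ys → Extremal R ys → Extremal R xs
  Extremal-resp-⊆ []                 []         = []
  Extremal-resp-⊆ (_ Sublist.∷ʳ sub) e          = Extremal-resp-⊆ sub (Extremal-tail e)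
  Extremal-resp-⊆ (refl ∷ sub)       (min∷ r e) = min∷ (All-resp-⊆ sub r) (Extremal-resp-⊆ sub e)
  Extremal-resp-⊆ (refl ∷ sub)       (max∷ r e) = max∷ (All-resp-⊆ sub r) (Extremal-resp-⊆ sub e)

  module _ {f : B → A} where

    Extremal-map⁺ : Extremal (R on f) xs → Extremal R (map f xs)
    Extremal-map⁺ []         = []
    Extremal-map⁺ (min∷ r e) = min∷ (All.map⁺ r) (Extremal-map⁺ e)
    Extremal-map⁺ (max∷ r e) = max∷ (All.map⁺ r) (Extremal-map⁺ e)

    Extremal-map⁻ : Extremal R (map f xs) → Extremal (R on f) xs
    Extremal-map⁻ {xs = []}    []         = []
    Extremal-map⁻ {xs = _ ∷ _} (min∷ r e) = min∷ (All.map⁻ r) (Extremal-map⁻ e)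
    Extremal-map⁻ {xs = _ ∷ _} (max∷ r e) = max∷ (All.map⁻ r) (Extremal-map⁻ e)

module _ {_<_ : Rel A ℓ} (<-trans : Transitive _<_) (<-cmp : Trichotomous _≡_ _<_) where

  SortedInterleaving : List A → List A → Set _
  SortedInterleaving xs ys = ∃ λ zs → Interleaving xs ys zs × Linked _<_ zs

  private
    -- The recursive call on the tail of the first list is passed in, so that
    -- both recursions are structural.
    merge-∷ : Linked _<_ (x ∷ xs) → (∀ ys → Linked _<_ ys → Disjoint xs ys → SortedInterleaving xs ys) →
              ∀ ys → Linked _<_ ys → Disjoint (x ∷ xs) ys → SortedInterleaving (x ∷ xs) ys
    merge-∷ {x} {xs} lx merge-xs [] _ _ = x ∷ xs , left (Pointwise.refl refl) , lx
    merge-∷ {x} lx merge-xs (y ∷ ys) ly disj with <-cmp x y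
    ... | tri≈ _ x≡y _ = ⊥-elim (disj (here refl , here x≡y))
    ... | tri< x<y _ _ =
      let zs , sp , lz = merge-xs (y ∷ ys) ly (λ (p , q) → disj (there p , q))
      in  x ∷ zs , consˡ sp ,
          All⇒Linked-∷ (All-interleaving sp (Linked⇒All-head <-trans lx) (Linked⇒All <-trans x<y ly)) lz
    ... | tri> _ _ y<x =
      let zs , sp , lz = merge-∷ lx merge-xs ys (Linked.tail ly) (λ (p , q) → disj (p , there q))
      in  y ∷ zs , consʳ sp ,
          All⇒Linked-∷ (All-interleaving sp (Linked⇒All <-trans y<x lx) (Linked⇒All-head <-trans ly)) lz

  merge : ∀ xs ys → Linked _<_ xs → Linked _<_ ys → Disjoint xs ys → SortedInterleaving xs ys
  merge []       ys _  ly _    = ys , right (Pointwise.refl refl) , ly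
  merge (x ∷ xs) ys lx ly disj = merge-∷ lx (λ ys′ → merge xs ys′ (Linked.tail lx)) ys ly disj

module _ {n : ℕ} where

  extremal⇒avoids : {vs : List (Fin n)} → Extremal _<_ vs → Avoids213-231 vs
  extremal⇒avoids e =
    (λ (_ , _ , _ , sub , b<a , a<c) → ¬213 (Extremal-resp-⊆ sub e) b<a a<c) ,
    (λ (_ , _ , _ , sub , c<a , a<b) → ¬231 (Extremal-resp-⊆ sub e) c<a a<b)
    where
    ¬213 : ∀ {a b c} → Extremal _<_ (a ∷ b ∷ c ∷ []) → b < a → a < c → ⊥
    ¬213 (min∷ (a<b ∷ _) _)      b<a _   = <-asym a<b b<a
    ¬213 (max∷ (_ ∷ c<a ∷ []) _) _   a<c = <-asym a<c c<a
    ¬231 : ∀ {a b c} → Extremal _<_ (a ∷ b ∷ c ∷ []) → c < a → a < b → ⊥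
    ¬231 (min∷ (_ ∷ a<c ∷ []) _) c<a _   = <-asym a<c c<a
    ¬231 (max∷ (b<a ∷ _) _)      _   a<b = <-asym a<b b<a

  avoids-∷⁻ : {v : Fin n} {vs : List (Fin n)} → Avoids213-231 (v ∷ vs) → Avoids213-231 vs
  avoids-∷⁻ {v} (¬213 , ¬231) =
    (λ (a , b , c , sub , h) → ¬213 (a , b , c , v Sublist.∷ʳ sub , h)) ,
    (λ (a , b , c , sub , h) → ¬231 (a , b , c , v Sublist.∷ʳ sub , h))

  avoids⇒head-extremal : {v : Fin n} {vs : List (Fin n)} → Unique (v ∷ vs) → Avoids213-231 (v ∷ vs) →
                         All (v <_) vs ⊎ All (_< v) vs
  avoids⇒head-extremal {vs = []} _ _ = inj₁ []
  avoids⇒head-extremal {v} {w ∷ vs} (v∉ ∷ _) (¬213 , ¬231) with <-cmp v w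
  ... | tri≈ _ v≡w _ = ⊥-elim (All.head v∉ v≡w)
  ... | tri< v<w _ _ = inj₁ (v<w ∷ All.tabulate above)
    where
    above : ∀ {u} → u ∈ vs → v < u
    above {u} u∈vs with <-cmp v u
    ... | tri< v<u _ _ = v<u
    ... | tri≈ _ v≡u _ = ⊥-elim (All.lookup v∉ (there u∈vs) v≡u)
    ... | tri> _ _ u<v = ⊥-elim (¬231 (v , w , u , refl ∷ refl ∷ from∈ u∈vs , u<v , v<w))
  ... | tri> _ _ w<v = inj₂ (w<v ∷ All.tabulate below)
    where
    below : ∀ {u} → u ∈ vs → u < v
    below {u} u∈vs with <-cmp v u
    ... | tri< v<u _ _ = ⊥-elim (¬213 (v , w , u , refl ∷ refl ∷ from∈ u∈vs , w<v , v<u))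
    ... | tri≈ _ v≡u _ = ⊥-elim (All.lookup v∉ (there u∈vs) v≡u)
    ... | tri> _ _ u<v = u<v

  avoids⇒extremal : {vs : List (Fin n)} → Unique vs → Avoids213-231 vs → Extremal _<_ vs
  avoids⇒extremal {[]}     _ _ = []
  avoids⇒extremal {v ∷ vs} u@(_ ∷ u′) av with avoids⇒head-extremal u av
  ... | inj₁ above = min∷ above (avoids⇒extremal u′ (avoids-∷⁻ av))
  ... | inj₂ below = max∷ below (avoids⇒extremal u′ (avoids-∷⁻ av))

module _ {n : ℕ} (π : Fin n → Fin n) where

  private
    _≺_ : Rel (Fin n) _
    _≺_ = _<_ on π

    ≺-trans : Transitive _≺_
    ≺-trans = <-trans

    ≻-trans : Transitive (flip _≺_)
    ≻-trans p q = <-trans q p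

  ascentsFrom-⊆ : ∀ x r → ascentsFrom π x r ⊆ x ∷ r
  ascentsFrom-⊆ x []      = refl ∷ []
  ascentsFrom-⊆ x (y ∷ r) with π x <? π y
  ... | yes _ = refl ∷ ascentsFrom-⊆ y r
  ... | no  _ = x Sublist.∷ʳ ascentsFrom-⊆ y r

  descentsFrom-⊆ : ∀ x r → descentsFrom π x r ⊆ x ∷ r
  descentsFrom-⊆ x []      = refl ∷ []
  descentsFrom-⊆ x (y ∷ r) with π y <? π x
  ... | yes _ = refl ∷ descentsFrom-⊆ y r
  ... | no  _ = x Sublist.∷ʳ descentsFrom-⊆ y r

  ascentsFrom-last : ∀ {v} x r → last (x ∷ r) ≡ just v → last (ascentsFrom π x r) ≡ just v
  ascentsFrom-last x []      e = e
  ascentsFrom-last x (y ∷ r) e with π x <? π y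
  ... | yes _ = last-∷ (ascentsFrom π y r) (ascentsFrom-last y r e)
  ... | no  _ = ascentsFrom-last y r e

  descentsFrom-last : ∀ {v} x r → last (x ∷ r) ≡ just v → last (descentsFrom π x r) ≡ just v
  descentsFrom-last x []      e = e
  descentsFrom-last x (y ∷ r) e with π y <? π x
  ... | yes _ = last-∷ (descentsFrom π y r) (descentsFrom-last y r e)
  ... | no  _ = descentsFrom-last y r e

  ascentsFrom-increasing : ∀ x r → Extremal _≺_ (x ∷ r) → Linked _≺_ (ascentsFrom π x r)
  ascentsFrom-increasing x []      _ = [-]
  ascentsFrom-increasing x (y ∷ r) e with π x <? π y
  ascentsFrom-increasing x (y ∷ r) (min∷ above e) | yes _ =
    All⇒Linked-∷ (All-resp-⊆ (ascentsFrom-⊆ y r) above) (ascentsFrom-increasing y r e)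
  ascentsFrom-increasing x (y ∷ r) (max∷ (y≺x ∷ _) _) | yes x≺y = ⊥-elim (<-asym x≺y y≺x)
  ascentsFrom-increasing x (y ∷ r) e | no _ = ascentsFrom-increasing y r (Extremal-tail e)

  descentsFrom-decreasing : ∀ x r → Extremal _≺_ (x ∷ r) → Linked (flip _≺_) (descentsFrom π x r)
  descentsFrom-decreasing x []      _ = [-]
  descentsFrom-decreasing x (y ∷ r) e with π y <? π x
  descentsFrom-decreasing x (y ∷ r) (max∷ below e) | yes _ =
    All⇒Linked-∷ (All-resp-⊆ (descentsFrom-⊆ y r) below) (descentsFrom-decreasing y r e)
  descentsFrom-decreasing x (y ∷ r) (min∷ (x≺y ∷ _) _) | yes y≺x = ⊥-elim (<-asym x≺y y≺x)
  descentsFrom-decreasing x (y ∷ r) e | no _ = descentsFrom-decreasing y r (Extremal-tail e)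

  length-ascentsFrom+descentsFrom : ∀ x r → Extremal _≺_ (x ∷ r) →
    length (ascentsFrom π x r) + length (descentsFrom π x r) ≡ suc (length (x ∷ r))
  length-ascentsFrom+descentsFrom x [] _ = refl
  length-ascentsFrom+descentsFrom x (y ∷ r) e with π x <? π y | π y <? π x
  ... | yes x≺y | yes y≺x = ⊥-elim (<-asym x≺y y≺x)
  ... | yes _   | no _    = cong suc (length-ascentsFrom+descentsFrom y r (Extremal-tail e))
  ... | no _    | yes _   =
    trans (+-suc _ _) (cong suc (length-ascentsFrom+descentsFrom y r (Extremal-tail e)))
  length-ascentsFrom+descentsFrom x (y ∷ r) (min∷ (x≺y ∷ _) _) | no x⊀y | no _ = ⊥-elim (x⊀y x≺y)
  length-ascentsFrom+descentsFrom x (y ∷ r) (max∷ (y≺x ∷ _) _) | no _ | no y⊀x = ⊥-elim (y⊀x y≺x)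

  ascentsFrom-IncEndingAt : ∀ {f x r} → IsSubseq (x ∷ r) → Extremal _≺_ (x ∷ r) →
                            last (x ∷ r) ≡ just f → IncEndingAt π f (ascentsFrom π x r)
  ascentsFrom-IncEndingAt {x = x} {r} sub extremal last-s =
    Linked-resp-⊆ <-trans (ascentsFrom-⊆ x r) sub ,
    ascentsFrom-increasing x r extremal ,
    ascentsFrom-last x r last-s

  descentsFrom-DecEndingAt : ∀ {f x r} → IsSubseq (x ∷ r) → Extremal _≺_ (x ∷ r) →
                             last (x ∷ r) ≡ just f → DecEndingAt π f (descentsFrom π x r)
  descentsFrom-DecEndingAt {x = x} {r} sub extremal last-s =
    Linked-resp-⊆ <-trans (descentsFrom-⊆ x r) sub ,
    descentsFrom-decreasing x r extremal ,
    descentsFrom-last x r last-s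

  interleaving-extremal : ∀ {f is js zs} → Linked _≺_ is → All (_≺ f) is →
                          Linked (flip _≺_) js → All (f ≺_) js →
                          Interleaving is js zs → Extremal _≺_ (zs ∷ʳ f)
  interleaving-extremal _ _ _ _ [] = min∷ [] []
  interleaving-extremal inc (i≺f ∷ below) dec above (consˡ sp) =
    min∷ (All.++⁺ (All-interleaving sp (Linked⇒All-head ≺-trans inc)
                                       (All.map (≺-trans i≺f) above))
                  (i≺f ∷ []))
         (interleaving-extremal (Linked.tail inc) below dec above sp)
  interleaving-extremal inc below dec (f≺j ∷ above) (consʳ sp) =
    max∷ (All.++⁺ (All-interleaving sp (All.map (λ i≺f → ≺-trans i≺f f≺j) below)
                                       (Linked⇒All-head ≻-trans dec))
                  (f≺j ∷ []))
         (interleaving-extremal inc below (Linked.tail dec) above sp)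

  merge-ending-at : ∀ {f is js} → IncEndingAt π f is → DecEndingAt π f js →
                    ∃ λ zs → AvoidEndingAt π f zs × length is + length js ≡ suc (length zs)
  merge-ending-at {f} {is₀} {js₀} (sub-is , inc , last-is) (sub-js , dec , last-js)
    with last⇒∷ʳ {xs = is₀} last-is | last⇒∷ʳ {xs = js₀} last-js
  ... | is , refl | js , refl
    with Linked-∷ʳ⁻ <-trans sub-is | Linked-∷ʳ⁻ <-trans sub-js
       | Linked-∷ʳ⁻ ≺-trans inc     | Linked-∷ʳ⁻ ≻-trans dec
  ... | sub-is′ , is<f | sub-js′ , js<f | inc′ , is≺f | dec′ , f≺js
    with merge <-trans <-cmp is js sub-is′ sub-js′
           (λ (v∈is , v∈js) → <-asym (All.lookup is≺f v∈is) (All.lookup f≺js v∈js))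
  ... | zs , sp , sub-zs =
    zs ∷ʳ f ,
    (Linked-∷ʳ⁺ sub-zs (All-interleaving sp is<f js<f) ,
     extremal⇒avoids (Extremal-map⁺ (interleaving-extremal inc′ is≺f dec′ f≺js sp)) ,
     trans (last-map π (zs ∷ʳ f)) (cong (Maybe.map π) (last-∷ʳ zs f))) ,
    (begin
      length (is ∷ʳ f) + length (js ∷ʳ f)  ≡⟨ cong₂ _+_ (length-∷ʳ is f) (length-∷ʳ js f) ⟩
      suc (length is) + suc (length js)    ≡⟨ cong suc (+-suc (length is) (length js)) ⟩
      suc (suc (length is + length js))    ≡⟨ cong (suc ∘ suc) (interleave-length sp) ⟨
      suc (suc (length zs))                ≡⟨ cong suc (length-∷ʳ zs f) ⟨
      suc (length (zs ∷ʳ f))               ∎)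
    where open ≡-Reasoning

  length-inc+dec≤ : ∀ {f s is js} → IsLongest (AvoidEndingAt π f) s →
                    IncEndingAt π f is → DecEndingAt π f js → length is + length js ℕ.≤ suc (length s)
  length-inc+dec≤ {s = s} {is} {js} (_ , longest) inc dec with merge-ending-at inc dec
  ... | zs , avoid , length-zs = begin
    length is + length js  ≡⟨ length-zs ⟩
    suc (length zs)        ≤⟨ s≤s (longest zs avoid) ⟩
    suc (length s)         ∎
    where open ≤-Reasoning

  subseq-avoiding⇒extremal : IsPermutation π → ∀ {s} → IsSubseq s → Avoids213-231 (vals π s) → Extremal _≺_ s
  subseq-avoiding⇒extremal inj {s} sub avoid =
    Extremal-map⁻ (avoids⇒extremal distinct avoid)
    where
    distinct : Unique (vals π s)
    distinct = Unique.map⁺ inj (AllPairs.map <⇒≢ (Linked⇒AllPairs <-trans sub))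

proposition4 : (n : ℕ) (π : Fin n → Fin n) → IsPermutation π → (f : Fin n) → (s : List (Fin n)) → IsLongest (AvoidEndingAt π f) s → IsLongest (IncEndingAt π f) (ascentsAndLast π s) × IsLongest (DecEndingAt π f) (descentsAndLast π s)
proposition4 n π inj f []      ((_ , _ , ()) , _)
proposition4 n π inj f (x ∷ r) longest@((sub , avoid , last-vals) , _) =
  (inc-asc , λ is inc → +-cancelʳ-≤ (length desc) _ _ (length-inc+dec≤asc+desc inc dec-desc)) ,
  (dec-desc , λ js dec → +-cancelˡ-≤ (length asc) _ _ (length-inc+dec≤asc+desc inc-asc dec))
  where
  asc desc : List (Fin n)
  asc  = ascentsFrom π x r
  desc = descentsFrom π x r

  extremal : Extremal (_<_ on π) (x ∷ r)
  extremal = subseq-avoiding⇒extremal π inj sub avoid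

  last-s : last (x ∷ r) ≡ just f
  last-s = last-map-injective {xs = x ∷ r} inj last-vals

  inc-asc : IncEndingAt π f asc
  inc-asc = ascentsFrom-IncEndingAt π sub extremal last-s

  dec-desc : DecEndingAt π f desc
  dec-desc = descentsFrom-DecEndingAt π sub extremal last-s

  length-inc+dec≤asc+desc : ∀ {is js} → IncEndingAt π f is → DecEndingAt π f js →
                            length is + length js ℕ.≤ length asc + length desc
  length-inc+dec≤asc+desc inc dec =
    ≤-trans (length-inc+dec≤ π longest inc dec)
            (≤-reflexive (sym (length-ascentsFrom+descentsFrom π x r extremal)))
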